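{- $\pi(P\square P)\le 12$, where $P$ is the two-way infinite path.
   Context: $P$ is the graph with vertex set $\mathbb{Z}$ where $i$ and $i+1$ are adjacent. For graphs $G,H$, the Cartesian product $G\square H$ has vertex set $V(G)\times V(H)$, with $(g,h)\sim(g',h')$ iff ($g=g'$ and $hh'\in E(H)$) or ($h=h'$ and $gg'\in E(G)$); thus $P\square P$ is the infinite square grid on $\mathbb{Z}^2$. A vertex coloring $c$ of a graph is non-repetitive if there is no path $v_1,\dots,v_{2k}$ ($k\ge1$, distinct vertices, consecutive ones adjacent) with $c(v_i)=c(v_{k+i})$ for all $1\le i\le k$. The non-repetitive chromatic number $\pi(G)$ is the minimum number of colors in a non-repetitive coloring of $G$. -}

module Defs where

open import Level using (Level; _⊔_; suc)
open import Data.Nat using (ℕ; _*_)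
open import Data.Fin using (Fin)
open import Data.Integer using (ℤ; _+_; 1ℤ)
open import Data.List using (List; []; _∷_; length; map; take; drop)
open import Data.List.Relation.Unary.Unique.Propositional using (Unique)
open import Data.Product using (_×_; ∃)
open import Data.Sum using (_⊎_)
open import Data.Empty using (⊥)
open import Relation.Nullary using (¬_)
open import Relation.Binary.PropositionalEquality using (_≡_)

record Graph (a ℓ : Level) : Set (Level.suc (a ⊔ ℓ)) where
  field
    V   : Set a
    Adj : V → V → Set ℓ
open Graph public

P : Graph Level.zero Level.zero
P = record { V = ℤ ; Adj = λ i j → (j ≡ i + 1ℤ) ⊎ (i ≡ j + 1ℤ) }

_□_ : ∀ {a ℓ b m} → Graph a ℓ → Graph b m → Graph (a ⊔ b) (a ⊔ b ⊔ ℓ ⊔ m)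
G □ H = record
  { V   = V G × V H
  ; Adj = λ { (g , h) (g' , h') →
              ((g ≡ g') × Adj H h h') ⊎ ((h ≡ h') × Adj G g g') } }
  where open import Data.Product using (_,_)

data Walk {a ℓ} (G : Graph a ℓ) : List (V G) → Set (a ⊔ ℓ) where
  walk-[] : Walk G []
  walk-[x] : ∀ x → Walk G (x ∷ [])
  walk-∷ : ∀ x y vs → Adj G x y → Walk G (y ∷ vs) → Walk G (x ∷ y ∷ vs)

IsPath : ∀ {a ℓ} (G : Graph a ℓ) → List (V G) → Set (a ⊔ ℓ)
IsPath G vs = Walk G vs × Unique vs

NonRepetitive : ∀ {a ℓ c} (G : Graph a ℓ) {C : Set c} → (V G → C) → Set (a ⊔ ℓ ⊔ c)
NonRepetitive G col =
  ∀ (k : ℕ) → 1 Data.Nat.≤ k → (vs : List (V G)) → length vs ≡ 2 * k → IsPath G vs →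
    ¬ (map col (take k vs) ≡ map col (drop k vs))

π≤ : ∀ {a ℓ} → Graph a ℓ → ℕ → Set (a ⊔ ℓ)
π≤ G n = ∃ λ (col : V G → Fin n) → NonRepetitive G col

-- Colour (x, y) by (W (x + y), t y), where t is a square-free word on 3 letters (the
-- differences of the Thue–Morse word) and W is a square-free word on 4 letters that has no
-- factor aba.  Along a grid path the diagonal coordinate x + y performs a ±1 walk, and y a
-- lazy walk moving with it.  For such W a ±1 walk whose two halves receive the same colours
-- has equal halves; so on a repetitively coloured path both halves agree in x + y, their
-- y-coordinates differ by a constant m, and m ≠ 0 gives a square in t while m = 0 makes the
-- path revisit a vertex.
--
-- W n = (parity of ⌊n/2⌋, β n) with β (4q + r) determined by r, β q and the first letter
-- at q.  The first letters force the length of a square in W to be a multiple of 4, and the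
-- recursion turns a square of length 4M into one of length M.

module Submission where

open import Defs
open import Data.Bool using (Bool; true; false; not; _xor_)
open import Data.Bool.Properties using (not-involutive; not-injective; not-¬; xor-identityʳ; xor-comm; ¬-not; not-distribˡ-xor; not-distribʳ-xor)
  renaming (_≟_ to _≟ᵇ_)
open import Data.Nat as ℕ using (ℕ; zero; suc; z≤n; s≤s)
  renaming (_+_ to _+ℕ_; _*_ to _*ℕ_; _≤_ to _≤ℕ_; _<_ to _<ℕ_; _∸_ to _∸ℕ_)
import Data.Nat.Properties as ℕ
open import Data.Nat.Induction using (<-rec)
open import Data.Integer using (ℤ; +_; -[1+_]; _+_; _-_; -_; _*_; 1ℤ; 0ℤ; -1ℤ; _≤_; +≤+; +<+; -≤+)
import Data.Integer.Properties as ℤ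
open import Data.Integer.DivMod using (_/ℕ_; _%ℕ_; n%ℕd<d; a≡a%ℕn+[a/ℕn]*n)
open import Data.Integer.Tactic.RingSolver using (solve-∀)
open import Data.Product using (_×_; _,_; proj₁; proj₂; ∃; ∃₂)
open import Data.Sum using (_⊎_; inj₁; inj₂)
open import Data.Empty using (⊥; ⊥-elim)
open import Data.Fin using (Fin; combine) renaming (zero to 0F; suc to sucF)
open import Data.Fin.Properties using (combine-injective)
open import Data.List using (List; []; _∷_; length; map; take; drop)
open import Data.List.Properties using (map-injective; map-∘)
open import Data.List.Relation.Unary.All using (All; _∷_)
open import Data.List.Relation.Unary.AllPairs using (_∷_)
open import Function using (_∘_; Injective)
open import Relation.Nullary using (¬_; yes; no; contradiction)
open import Relation.Binary.PropositionalEquality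

-- Squares, overlaps and lazy walks in ℤ

Square : {A : Set} → (ℤ → A) → ℤ → ℕ → Set
Square f p L = ∀ i → i <ℕ L → f (p + + i) ≡ f (p + + i + + L)

SquareFree : {A : Set} → (ℤ → A) → Set
SquareFree f = ∀ p L → 1 ≤ℕ L → ¬ Square f p L

Overlap : {A : Set} → (ℤ → A) → ℤ → ℕ → Set
Overlap X p L = ∀ i → i ≤ℕ L → X (p + + i) ≡ X (p + + i + + L)

square-start : ∀ {A : Set} (f : ℤ → A) p {L} → Square f p L → 1 ≤ℕ L → f p ≡ f (p + + L)
square-start f p {L} sq 1≤L =
  trans (cong f (sym (ℤ.+-identityʳ p))) (trans (sq 0 1≤L) (cong (λ z → f (z + + L)) (ℤ.+-identityʳ p)))

OverlapFree : {A : Set} → (ℤ → A) → Set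
OverlapFree X = ∀ p L → 1 ≤ℕ L → ¬ Overlap X p L

data Direction : Set where
  up down : Direction

⟦_⟧ : Direction → ℤ
⟦ up ⟧ = 1ℤ
⟦ down ⟧ = -1ℤ

opposite : Direction → Direction
opposite up = down
opposite down = up

⟦⟧-injective : ∀ {d d'} → ⟦ d ⟧ ≡ ⟦ d' ⟧ → d ≡ d'
⟦⟧-injective {up} {up} _ = refl
⟦⟧-injective {down} {down} _ = refl

⟦opposite⟧ : ∀ d → ⟦ opposite d ⟧ ≡ - ⟦ d ⟧
⟦opposite⟧ up = refl
⟦opposite⟧ down = refl

there-and-back : ∀ d x → x + ⟦ d ⟧ + ⟦ opposite d ⟧ ≡ x
there-and-back up = solve-∀
there-and-back down = solve-∀

straight-or-back : ∀ d d' → d' ≡ d ⊎ d' ≡ opposite d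
straight-or-back up up = inj₁ refl
straight-or-back up down = inj₂ refl
straight-or-back down up = inj₂ refl
straight-or-back down down = inj₁ refl

length-1-square : ∀ {A : Set} (f : ℤ → A) a → f a ≡ f (a + 1ℤ) → Square f a 1
length-1-square f a eq zero _ = trans (cong f (ℤ.+-identityʳ a)) (trans eq (cong (λ z → f (z + 1ℤ)) (sym (ℤ.+-identityʳ a))))
length-1-square f a eq (suc _) (s≤s ())

Step : ℤ → ℤ → Set
Step a b = ∃ λ d → b ≡ a + ⟦ d ⟧

LazyStep : ℤ → ℤ → Set
LazyStep a b = b ≡ a ⊎ Step a b

LazyWalk : ℕ → (ℕ → ℤ) → Set
LazyWalk k z = ∀ i → i <ℕ k → LazyStep (z i) (z (suc i))

squareFree-neighbours : ∀ {A : Set} {f : ℤ → A} → SquareFree f → ∀ a d → f a ≢ f (a + ⟦ d ⟧)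
squareFree-neighbours {f = f} sf a up eq = sf a 1 (s≤s z≤n) (length-1-square f a eq)
squareFree-neighbours {f = f} sf a down eq =
  sf (a - 1ℤ) 1 (s≤s z≤n) (length-1-square f (a - 1ℤ) (trans (sym eq) (cong f (back a))))
  where back : ∀ a → a ≡ a - 1ℤ + 1ℤ
        back = solve-∀

lazy-walk-hits : ∀ n z → LazyWalk n z → ∀ j → z 0 ≤ j → j ≤ z n → ∃ λ i → i ≤ℕ n × z i ≡ j
lazy-walk-hits zero z _ j lo hi = 0 , z≤n , ℤ.≤-antisym lo hi
lazy-walk-hits (suc n) z walk j lo hi with j ℤ.≤? z n
... | yes j≤zn with lazy-walk-hits n z (λ i i<n → walk i (ℕ.m<n⇒m<1+n i<n)) j lo j≤zn
...   | i , i≤n , hit = i , ℕ.m≤n⇒m≤1+n i≤n , hit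
lazy-walk-hits (suc n) z walk j lo hi | no j≰zn with walk n ℕ.≤-refl
... | inj₁ stay = contradiction (subst (j ≤_) stay hi) j≰zn
... | inj₂ (up , next) = suc n , ℕ.≤-refl ,
  ℤ.≤-antisym (subst (_≤ j) (trans (ℤ.+-comm 1ℤ (z n)) (sym next)) (ℤ.i<j⇒suc[i]≤j (ℤ.≰⇒> j≰zn))) hi
... | inj₂ (down , next) = contradiction
  (ℤ.≤-trans hi (ℤ.≤-trans (ℤ.≤-reflexive next) (subst (z n + -1ℤ ≤_) (ℤ.+-identityʳ (z n)) (ℤ.+-monoʳ-≤ (z n) -≤+)))) j≰zn

square-from-lazy-walk : ∀ {A : Set} (f : ℤ → A) k z → LazyWalk k z → ∀ L → z k ≡ z 0 + + L →
                        (∀ i → i <ℕ k → f (z i) ≡ f (z i + + L)) → Square f (z 0) L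
square-from-lazy-walk f k z walk L end shifted t t<L
  with lazy-walk-hits k z walk (z 0 + + t) (ℤ.i≤i+j (z 0) (+ t))
         (subst (z 0 + + t ≤_) (sym end) (ℤ.+-monoʳ-≤ (z 0) (+≤+ (ℕ.<⇒≤ t<L))))
... | i , i≤k , hit with i ℕ.≟ k
...   | yes refl = ⊥-elim (ℤ.<-irrefl (trans (sym hit) end) (ℤ.+-monoʳ-< (z 0) (+<+ t<L)))
...   | no i≢k = trans (cong f (sym hit)) (trans (shifted i (ℕ.≤∧≢⇒< i≤k i≢k)) (cong (λ x → f (x + + L)) hit))

squareFree-reverse : ∀ {A : Set} {f : ℤ → A} → SquareFree f → SquareFree (f ∘ -_)
squareFree-reverse {f = f} sf p L 1≤L sq = sf (- p - + L - + L + 1ℤ) L 1≤L reversed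
  where
  arith₁ : ∀ p x y → - p - (1ℤ + x + y) - (1ℤ + x + y) + 1ℤ + x ≡ - (p + y + (1ℤ + x + y))
  arith₁ = solve-∀
  arith₂ : ∀ p x y → - p - (1ℤ + x + y) - (1ℤ + x + y) + 1ℤ + x + (1ℤ + x + y) ≡ - (p + y)
  arith₂ = solve-∀
  reversed : Square f (- p - + L - + L + 1ℤ) L
  reversed i i<L = begin
    f (q + + i)                  ≡⟨ cong f (trans (cong (λ l → - p - l - l + 1ℤ + + i) L≡)
                                                  (trans (arith₁ p (+ i) (+ i′)) (cong (λ l → - (p + + i′ + l)) (sym L≡)))) ⟩
    f (- (p + + i′ + + L))       ≡⟨ sym (sq i′ (ℕ.∸-monoʳ-< (s≤s z≤n) i<L)) ⟩
    f (- (p + + i′))             ≡⟨ cong f (sym (trans (cong (λ l → - p - l - l + 1ℤ + + i + l) L≡) (arith₂ p (+ i) (+ i′)))) ⟩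
    f (q + + i + + L)            ∎
    where
    open ≡-Reasoning
    q : ℤ
    q = - p - + L - + L + 1ℤ
    i′ : ℕ
    i′ = L ∸ℕ suc i
    L≡ : + L ≡ 1ℤ + + i + + i′
    L≡ = cong +_ (sym (ℕ.m+[n∸m]≡n i<L))

negate-lazy-step : ∀ {a b} → LazyStep a b → LazyStep (- a) (- b)
negate-lazy-step (inj₁ stay) = inj₁ (cong -_ stay)
negate-lazy-step {a} (inj₂ (d , next)) = inj₂ (opposite d , trans (cong -_ next) (trans (ℤ.neg-distrib-+ a ⟦ d ⟧) (cong (λ x → - a + x) (sym (⟦opposite⟧ d)))))

-- The walk passes every point between z 0 and z 0 + m, giving a square of length |m|.
lazy-walk-translation : ∀ {A : Set} {f : ℤ → A} → SquareFree f → ∀ k z → LazyWalk k z →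
                        ∀ m → m ≢ 0ℤ → z k ≡ z 0 + m → ¬ (∀ i → i <ℕ k → f (z i) ≡ f (z i + m))
lazy-walk-translation sf k z walk (+ zero) m≢0 _ _ = m≢0 refl
lazy-walk-translation {f = f} sf k z walk (+ suc L) _ end shifted =
  sf (z 0) (suc L) (s≤s z≤n) (square-from-lazy-walk f k z walk (suc L) end shifted)
lazy-walk-translation {f = f} sf k z walk -[1+ L ] _ end shifted =
  squareFree-reverse {f = f} sf (- z 0) (suc L) (s≤s z≤n)
    (square-from-lazy-walk (f ∘ -_) k (-_ ∘ z) (λ i i<k → negate-lazy-step (walk i i<k)) (suc L)
      (trans (cong -_ end) (ℤ.neg-distrib-+ (z 0) -[1+ L ]))
      (λ i i<k → trans (cong f (ℤ.neg-involutive (z i))) (trans (shifted i i<k) (cong f (arith (z i) (+ suc L))))))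
  where arith : ∀ a x → a - x ≡ - (- a + x)
        arith = solve-∀

+-cancelˡ : ∀ a {x y} → a + x ≡ a + y → x ≡ y
+-cancelˡ a {x} {y} eq = trans (arith a x) (trans (cong (λ z → - a + z) eq) (sym (arith a y)))
  where arith : ∀ a x → x ≡ - a + (a + x)
        arith = solve-∀

direction : ℤ → ℤ → Direction
direction a b with b ℤ.≟ a + 1ℤ
... | yes _ = up
... | no _ = down

direction-unique : ∀ {a b d} → b ≡ a + ⟦ d ⟧ → direction a b ≡ d
direction-unique {a} {b} {d} eq with b ℤ.≟ a + 1ℤ
... | yes b≡a+1 = ⟦⟧-injective (+-cancelˡ a (trans (sym b≡a+1) eq))
direction-unique {d = up} eq | no b≢a+1 = ⊥-elim (b≢a+1 eq)
direction-unique {d = down} eq | no _ = refl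

-- Rigidity of walks

stays-above-2 : ∀ k (g : ℕ → ℤ) → (∀ j → suc j <ℕ k → ∃ λ d → g (suc j) ≡ g j + ⟦ d ⟧ + ⟦ d ⟧) →
                (∀ j → j <ℕ k → g j ≢ 1ℤ × g j ≢ + 2) →
                ∀ t → g 0 ≡ + (3 +ℕ t) → ∀ j → j <ℕ k → ∃ λ t′ → g j ≡ + (3 +ℕ t′)
stays-above-2 k g moves avoids t start zero _ = t , start
stays-above-2 k g moves avoids t start (suc j) sj<k
  with stays-above-2 k g moves avoids t start j (ℕ.<⇒≤ sj<k) | moves j sj<k
... | t′ , gj | up , next = t′ +ℕ 2 , trans next (trans (cong (λ x → x + 1ℤ + 1ℤ) gj) (cong (λ n → + (3 +ℕ n)) (ℕ.+-assoc t′ 1 1)))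
... | zero , gj | down , next = ⊥-elim (proj₁ (avoids (suc j) sj<k) (trans next (cong (λ x → x + -1ℤ + -1ℤ) gj)))
... | suc zero , gj | down , next = ⊥-elim (proj₂ (avoids (suc j) sj<k) (trans next (cong (λ x → x + -1ℤ + -1ℤ) gj)))
... | suc (suc t″) , gj | down , next = t″ , trans next (cong (λ x → x + -1ℤ + -1ℤ) gj)

ends-sum-≢±2 : ∀ k (g : ℕ → ℤ) → (∀ j → suc j <ℕ k → ∃ λ d → g (suc j) ≡ g j + ⟦ d ⟧ + ⟦ d ⟧) →
               (∀ j → j <ℕ k → ∀ d → g j ≢ ⟦ d ⟧ × g j ≢ ⟦ d ⟧ + ⟦ d ⟧) →
               ∀ ℓ → ℓ <ℕ k → ∀ d → g 0 + g ℓ ≢ ⟦ d ⟧ + ⟦ d ⟧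
ends-sum-≢±2 k g moves avoids ℓ ℓ<k d ends = excluded (g 0) refl
  where
  0<k : 0 <ℕ k
  0<k = ℕ.≤-<-trans z≤n ℓ<k
  too-big : ∀ t t′ d → + (3 +ℕ t) + + (3 +ℕ t′) ≢ ⟦ d ⟧ + ⟦ d ⟧
  too-big t t′ up eq with ℤ.+-injective eq
  ... | ()
  too-big t t′ down ()
  negate : ∀ d y → - (y + ⟦ d ⟧ + ⟦ d ⟧) ≡ - y + ⟦ opposite d ⟧ + ⟦ opposite d ⟧
  negate up = solve-∀
  negate down = solve-∀
  moves⁻ : ∀ j → suc j <ℕ k → ∃ λ d → - g (suc j) ≡ - g j + ⟦ d ⟧ + ⟦ d ⟧
  moves⁻ j sj<k with moves j sj<k
  ... | d , next = opposite d , trans (cong -_ next) (negate d (g j))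
  avoids⁺ : ∀ j → j <ℕ k → g j ≢ 1ℤ × g j ≢ + 2
  avoids⁺ j j<k = avoids j j<k up
  avoids⁻ : ∀ j → j <ℕ k → - g j ≢ 1ℤ × - g j ≢ + 2
  avoids⁻ j j<k = (λ eq → proj₁ (avoids j j<k down) (unnegate eq)) , (λ eq → proj₂ (avoids j j<k down) (unnegate eq))
    where
    unnegate : ∀ {y} → - g j ≡ y → g j ≡ - y
    unnegate eq = trans (sym (ℤ.neg-involutive (g j))) (cong -_ eq)
  excluded : ∀ y → g 0 ≢ y
  excluded (+ zero) g₀ = proj₂ (avoids ℓ ℓ<k d) (trans (sym (ℤ.+-identityˡ (g ℓ))) (trans (cong (_+ g ℓ) (sym g₀)) ends))
  excluded (+ 1) g₀ = proj₁ (avoids⁺ 0 0<k) g₀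
  excluded (+ 2) g₀ = proj₂ (avoids⁺ 0 0<k) g₀
  excluded (+ suc (suc (suc t))) g₀ with stays-above-2 k g moves avoids⁺ t g₀ ℓ ℓ<k
  ... | t′ , gℓ = too-big t t′ d (trans (cong₂ _+_ (sym g₀) (sym gℓ)) ends)
  excluded -[1+ 0 ] g₀ = proj₁ (avoids 0 0<k down) g₀
  excluded -[1+ 1 ] g₀ = proj₂ (avoids 0 0<k down) g₀
  excluded -[1+ suc (suc t) ] g₀ with stays-above-2 k (λ j → - g j) moves⁻ avoids⁻ t (cong -_ g₀) ℓ ℓ<k
  ... | t′ , gℓ = too-big t t′ (opposite d)
    (trans (cong₂ _+_ (sym (cong -_ g₀)) (sym gℓ)) (trans (sym (ℤ.neg-distrib-+ (g 0) (g ℓ))) (trans (cong -_ ends) (negate-double d))))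
    where
    negate-double : ∀ d → - (⟦ d ⟧ + ⟦ d ⟧) ≡ ⟦ opposite d ⟧ + ⟦ opposite d ⟧
    negate-double up = refl
    negate-double down = refl

first-half : ∀ {j k} → j <ℕ k → suc j <ℕ k +ℕ k
first-half {j} {k} j<k = ℕ.≤-<-trans j<k (ℕ.m<m+n k (ℕ.≤-<-trans z≤n j<k))

second-half : ∀ {j k} → suc j <ℕ k → suc (k +ℕ j) <ℕ k +ℕ k
second-half {j} {k} sj<k = subst (_<ℕ k +ℕ k) (ℕ.+-suc k j) (ℕ.+-monoʳ-< k sj<k)

-- Two-step moves are straight (±2) or return, and f tells the two apart, so the
-- second half of the walk moves parallel or antiparallel to the first.  Parallel
-- halves differ by a translation, which vanishes as f is square-free; for
-- antiparallel halves the gap s(k + j) − s(j) moves by ±2 avoiding ±1 and ±2, yet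
-- gap 0 + gap (k − 1) = ±2.
module WalkRigidity {A : Set} {f : ℤ → A} (squareFree : SquareFree f) (no-aba : ∀ a → f a ≢ f (a + + 2)) where

  neighbours : ∀ a d → f a ≢ f (a + ⟦ d ⟧)
  neighbours = squareFree-neighbours {f = f} squareFree

  two-apart : ∀ a d → f a ≢ f (a + ⟦ d ⟧ + ⟦ d ⟧)
  two-apart a up eq = no-aba a (trans eq (cong f (arith a)))
    where arith : ∀ a → a + 1ℤ + 1ℤ ≡ a + + 2
          arith = solve-∀
  two-apart a down eq = no-aba (a + -1ℤ + -1ℤ) (trans (sym eq) (cong f (arith a)))
    where arith : ∀ a → a ≡ a + -1ℤ + -1ℤ + + 2
          arith = solve-∀

  same-shape : ∀ {X Y} a b a′ b′ → f X ≡ f Y → f (X + ⟦ a ⟧ + ⟦ b ⟧) ≡ f (Y + ⟦ a′ ⟧ + ⟦ b′ ⟧) →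
               (a′ ≡ a → b′ ≡ b) × (a′ ≡ opposite a → b′ ≡ opposite b)
  same-shape {X} {Y} a b a′ b′ e e′ with straight-or-back a b | straight-or-back a′ b′
  ... | inj₁ refl | inj₁ refl = (λ eq → eq) , (λ eq → eq)
  ... | inj₂ refl | inj₂ refl = cong opposite , cong opposite
  ... | inj₁ refl | inj₂ refl = ⊥-elim (two-apart X a (trans e (trans (cong f (sym (there-and-back a′ Y))) (sym e′))))
  ... | inj₂ refl | inj₁ refl = ⊥-elim (two-apart Y a′ (trans (sym e) (trans (cong f (sym (there-and-back a X))) e′)))

  module TwoHalves (k : ℕ) (s : ℕ → ℤ) (e : ℕ → Direction) (2≤k : 2 ≤ℕ k)
              (steps : ∀ i → suc i <ℕ k +ℕ k → s (suc i) ≡ s i + ⟦ e i ⟧)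
              (repeats : ∀ i → i <ℕ k → f (s i) ≡ f (s (k +ℕ i))) where

    step₁ : ∀ j → j <ℕ k → s (suc j) ≡ s j + ⟦ e j ⟧
    step₁ j j<k = steps j (first-half j<k)

    step₂ : ∀ j → suc j <ℕ k → s (k +ℕ suc j) ≡ s (k +ℕ j) + ⟦ e (k +ℕ j) ⟧
    step₂ j sj<k = trans (cong s (ℕ.+-suc k j)) (steps (k +ℕ j) (second-half sj<k))

    shapes : ∀ j → suc (suc j) <ℕ k → (e (k +ℕ j) ≡ e j → e (k +ℕ suc j) ≡ e (suc j)) ×
                                      (e (k +ℕ j) ≡ opposite (e j) → e (k +ℕ suc j) ≡ opposite (e (suc j)))
    shapes j ssj<k = same-shape (e j) (e (suc j)) (e (k +ℕ j)) (e (k +ℕ suc j)) (repeats j j<k)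
      (trans (cong f (sym two-steps)) (trans (repeats (suc (suc j)) ssj<k) (cong f two-steps′)))
      where
      sj<k : suc j <ℕ k
      sj<k = ℕ.<⇒≤ ssj<k
      j<k : j <ℕ k
      j<k = ℕ.<⇒≤ sj<k
      two-steps : s (suc (suc j)) ≡ s j + ⟦ e j ⟧ + ⟦ e (suc j) ⟧
      two-steps = trans (step₁ (suc j) sj<k) (cong (_+ ⟦ e (suc j) ⟧) (step₁ j j<k))
      two-steps′ : s (k +ℕ suc (suc j)) ≡ s (k +ℕ j) + ⟦ e (k +ℕ j) ⟧ + ⟦ e (k +ℕ suc j) ⟧
      two-steps′ = trans (step₂ (suc j) ssj<k) (cong (_+ ⟦ e (k +ℕ suc j) ⟧) (step₂ j sj<k))

    parallel : e (k +ℕ 0) ≡ e 0 → ∀ j → suc j <ℕ k → e (k +ℕ j) ≡ e j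
    parallel start zero _ = start
    parallel start (suc j) ssj<k = proj₁ (shapes j ssj<k) (parallel start j (ℕ.<⇒≤ ssj<k))

    antiparallel : e (k +ℕ 0) ≡ opposite (e 0) → ∀ j → suc j <ℕ k → e (k +ℕ j) ≡ opposite (e j)
    antiparallel start zero _ = start
    antiparallel start (suc j) ssj<k = proj₂ (shapes j ssj<k) (antiparallel start j (ℕ.<⇒≤ ssj<k))

    gap : ℕ → ℤ
    gap j = s (k +ℕ j) - s j

    gap-spec : ∀ j → s (k +ℕ j) ≡ s j + gap j
    gap-spec j = arith (s (k +ℕ j)) (s j)
      where arith : ∀ a b → a ≡ b + (a - b)
            arith = solve-∀

    translated : e (k +ℕ 0) ≡ e 0 → ∀ j → j <ℕ k → s (k +ℕ j) ≡ s j + gap 0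
    translated start zero _ = gap-spec 0
    translated start (suc j) sj<k = begin
      s (k +ℕ suc j)                 ≡⟨ step₂ j sj<k ⟩
      s (k +ℕ j) + ⟦ e (k +ℕ j) ⟧    ≡⟨ cong₂ _+_ (translated start j (ℕ.<⇒≤ sj<k)) (cong ⟦_⟧ (parallel start j sj<k)) ⟩
      s j + gap 0 + ⟦ e j ⟧          ≡⟨ arith (s j) (gap 0) ⟦ e j ⟧ ⟩
      s j + ⟦ e j ⟧ + gap 0          ≡⟨ cong (_+ gap 0) (sym (step₁ j (ℕ.<⇒≤ sj<k))) ⟩
      s (suc j) + gap 0              ∎
      where
      open ≡-Reasoning
      arith : ∀ a d x → a + d + x ≡ a + x + d
      arith = solve-∀

    parallel-halves-equal : e (k +ℕ 0) ≡ e 0 → ∀ i → i <ℕ k → s (k +ℕ i) ≡ s i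
    parallel-halves-equal start i i<k with gap 0 ℤ.≟ 0ℤ
    ... | yes gap≡0 = trans (translated start i i<k) (trans (cong (λ y → s i + y) gap≡0) (ℤ.+-identityʳ (s i)))
    ... | no gap≢0 = ⊥-elim (lazy-walk-translation {f = f} squareFree k s (λ i i<k → inj₂ (e i , step₁ i i<k)) (gap 0) gap≢0
                       (trans (cong s (sym (ℕ.+-identityʳ k))) (translated start 0 (ℕ.<-≤-trans (s≤s z≤n) 2≤k)))
                       (λ i i<k → trans (repeats i i<k) (cong f (translated start i i<k))))

    gap-avoids : ∀ j → j <ℕ k → ∀ d → gap j ≢ ⟦ d ⟧ × gap j ≢ ⟦ d ⟧ + ⟦ d ⟧
    gap-avoids j j<k d = (λ eq → neighbours (s j) d (trans (repeats j j<k) (cong f (trans (gap-spec j) (cong (λ y → s j + y) eq)))))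
                       , (λ eq → two-apart (s j) d (trans (repeats j j<k) (cong f (trans (gap-spec j) (trans (cong (λ y → s j + y) eq) (sym (ℤ.+-assoc (s j) _ _)))))))

    gap-step : e (k +ℕ 0) ≡ opposite (e 0) → ∀ j → suc j <ℕ k → gap (suc j) ≡ gap j + ⟦ opposite (e j) ⟧ + ⟦ opposite (e j) ⟧
    gap-step start j sj<k = trans (cong₂ _-_ (trans (step₂ j sj<k) (cong (λ d → s (k +ℕ j) + ⟦ d ⟧) (antiparallel start j sj<k)))
                                              (step₁ j (ℕ.<⇒≤ sj<k)))
                                  (arith (e j) (s (k +ℕ j)) (s j))
      where
      arith : ∀ d a b → a + ⟦ opposite d ⟧ - (b + ⟦ d ⟧) ≡ a - b + ⟦ opposite d ⟧ + ⟦ opposite d ⟧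
      arith up = solve-∀
      arith down = solve-∀

    sum-constant : e (k +ℕ 0) ≡ opposite (e 0) → ∀ j → j <ℕ k → s (k +ℕ j) + s j ≡ s (k +ℕ 0) + s 0
    sum-constant start zero _ = refl
    sum-constant start (suc j) sj<k =
      trans (cong₂ _+_ (trans (step₂ j sj<k) (cong (λ d → s (k +ℕ j) + ⟦ d ⟧) (antiparallel start j sj<k)))
                       (step₁ j (ℕ.<⇒≤ sj<k)))
            (trans (arith (e j) (s (k +ℕ j)) (s j)) (sum-constant start j (ℕ.<⇒≤ sj<k)))
      where
      arith : ∀ d a b → a + ⟦ opposite d ⟧ + (b + ⟦ d ⟧) ≡ a + b
      arith up = solve-∀
      arith down = solve-∀

    gap-ends : e (k +ℕ 0) ≡ opposite (e 0) → ∀ ℓ → k ≡ suc ℓ → gap 0 + gap ℓ ≡ ⟦ e ℓ ⟧ + ⟦ e ℓ ⟧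
    gap-ends start ℓ k≡1+ℓ = begin
      a - b + (a′ - b′)                   ≡⟨ arith₁ a b a′ b′ ⟩
      a - b + (a′ + b′ - b′ - b′)         ≡⟨ cong (λ u → a - b + (u - b′ - b′)) (sum-constant start ℓ ℓ<k) ⟩
      a - b + (a + b - b′ - b′)           ≡⟨ cong (λ u → u - b + (u + b - b′ - b′)) last-step ⟩
      b′ + x - b + (b′ + x + b - b′ - b′) ≡⟨ arith₂ b′ b x ⟩
      x + x                               ∎
      where
      open ≡-Reasoning
      ℓ<k : ℓ <ℕ k
      ℓ<k = subst (ℓ <ℕ_) (sym k≡1+ℓ) ℕ.≤-refl
      a b a′ b′ x : ℤ
      a = s (k +ℕ 0)
      b = s 0
      a′ = s (k +ℕ ℓ)
      b′ = s ℓ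
      x = ⟦ e ℓ ⟧
      arith₁ : ∀ a b a′ b′ → a - b + (a′ - b′) ≡ a - b + (a′ + b′ - b′ - b′)
      arith₁ = solve-∀
      arith₂ : ∀ b′ b x → b′ + x - b + (b′ + x + b - b′ - b′) ≡ x + x
      arith₂ = solve-∀
      last-step : a ≡ b′ + x
      last-step = trans (cong s (trans (ℕ.+-identityʳ k) k≡1+ℓ)) (step₁ ℓ ℓ<k)

    antiparallel-impossible : ∀ ℓ → k ≡ suc ℓ → e (k +ℕ 0) ≡ opposite (e 0) → ⊥
    antiparallel-impossible ℓ k≡1+ℓ start =
      ends-sum-≢±2 k gap (λ j sj<k → opposite (e j) , gap-step start j sj<k) gap-avoids
        ℓ (subst (ℓ <ℕ_) (sym k≡1+ℓ) ℕ.≤-refl) (e ℓ) (gap-ends start ℓ k≡1+ℓ)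

  walk-rigidity : ∀ k (s : ℕ → ℤ) (e : ℕ → Direction) → 1 ≤ℕ k →
                  (∀ i → suc i <ℕ k +ℕ k → s (suc i) ≡ s i + ⟦ e i ⟧) →
                  (∀ i → i <ℕ k → f (s i) ≡ f (s (k +ℕ i))) →
                  ∀ i → i <ℕ k → s (k +ℕ i) ≡ s i
  walk-rigidity 1 s e _ steps repeats _ _ =
    ⊥-elim (neighbours (s 0) (e 0) (trans (repeats 0 (s≤s z≤n)) (cong f (steps 0 (s≤s (s≤s z≤n))))))
  walk-rigidity k@(suc (suc ℓ)) s e _ steps repeats = by-shape (straight-or-back (e 0) (e (k +ℕ 0)))
    where
    open TwoHalves k s e (s≤s (s≤s z≤n)) steps repeats
    by-shape : (e (k +ℕ 0) ≡ e 0) ⊎ (e (k +ℕ 0) ≡ opposite (e 0)) → ∀ i → i <ℕ k → s (k +ℕ i) ≡ s i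
    by-shape (inj₁ par) = parallel-halves-equal par
    by-shape (inj₂ anti) = ⊥-elim (antiparallel-impossible (suc ℓ) refl anti)

-- Colouring the grid along its diagonals

nth : ∀ {a} {A : Set a} → A → List A → ℕ → A
nth d [] i = d
nth d (x ∷ xs) zero = x
nth d (x ∷ xs) (suc i) = nth d xs i

module _ {a} {A : Set a} (d : A) where

  nth-take : ∀ k xs i → i <ℕ k → nth d (take k xs) i ≡ nth d xs i
  nth-take (suc k) [] i _ = refl
  nth-take (suc k) (x ∷ xs) zero _ = refl
  nth-take (suc k) (x ∷ xs) (suc i) (s≤s i<k) = nth-take k xs i i<k

  nth-drop : ∀ k xs i → nth d (drop k xs) i ≡ nth d xs (k +ℕ i)
  nth-drop zero xs i = refl
  nth-drop (suc k) [] i = refl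
  nth-drop (suc k) (x ∷ xs) i = nth-drop k xs i

  nth-map : ∀ {b} {B : Set b} (f : A → B) → ∀ xs i → nth (f d) (map f xs) i ≡ f (nth d xs i)
  nth-map f [] i = refl
  nth-map f (x ∷ xs) zero = refl
  nth-map f (x ∷ xs) (suc i) = nth-map f xs i

  nth-All : ∀ {q} {Q : A → Set q} {xs} → All Q xs → ∀ i → i <ℕ length xs → Q (nth d xs i)
  nth-All (qx ∷ _) zero _ = qx
  nth-All (_ ∷ qxs) (suc i) (s≤s i<n) = nth-All qxs i i<n

nth-Walk : ∀ {a ℓ} {G : Graph a ℓ} {vs} → Walk G vs → ∀ d i → suc i <ℕ length vs → Adj G (nth d vs i) (nth d vs (suc i))
nth-Walk (walk-[x] x) d i (s≤s ())
nth-Walk (walk-∷ x y vs adj w) d zero _ = adj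
nth-Walk (walk-∷ x y vs adj w) d (suc i) (s≤s b) = nth-Walk w d i b

nonRepetitive-∘ : ∀ {a ℓ} {G : Graph a ℓ} {C D : Set} {col : V G → C} {h : C → D} →
                  Injective _≡_ _≡_ h → NonRepetitive G col → NonRepetitive G (h ∘ col)
nonRepetitive-∘ h-injective nonrep k 1≤k vs len path same =
  nonrep k 1≤k vs len path (map-injective h-injective (trans (sym (map-∘ (take k vs))) (trans same (map-∘ (drop k vs)))))

path-step : ∀ {a b} → Adj P a b → Step a b
path-step (inj₁ b≡a+1) = up , b≡a+1
path-step {a} {b} (inj₂ a≡b+1) = down , trans (arith b) (cong (_+ -1ℤ) (sym a≡b+1))
  where arith : ∀ b → b ≡ b + 1ℤ + -1ℤ
        arith = solve-∀

grid-step : ∀ {v v′ : ℤ × ℤ} → Adj (P □ P) v v′ →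
            ∃ λ d → (proj₁ v′ + proj₂ v′ ≡ proj₁ v + proj₂ v + ⟦ d ⟧) × (proj₂ v′ ≡ proj₂ v ⊎ proj₂ v′ ≡ proj₂ v + ⟦ d ⟧)
grid-step {x , y} (inj₁ (refl , adj)) with path-step adj
... | d , y′≡ = d , trans (cong (λ z → x + z) y′≡) (sym (ℤ.+-assoc x y ⟦ d ⟧)) , inj₂ y′≡
grid-step {x , y} (inj₂ (refl , adj)) with path-step adj
... | d , x′≡ = d , trans (cong (_+ y) x′≡) (arith x y ⟦ d ⟧) , inj₁ refl
  where arith : ∀ x y d → x + d + y ≡ x + y + d
        arith = solve-∀

module DiagonalColouring {A B : Set} {f : ℤ → A} {g : ℤ → B}
                         (f-squareFree : SquareFree f) (f-no-aba : ∀ a → f a ≢ f (a + + 2))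
                         (g-squareFree : SquareFree g) where

  open WalkRigidity f-squareFree f-no-aba using (walk-rigidity)

  colour : ℤ × ℤ → A × B
  colour (x , y) = f (x + y) , g y

  -- A grid walk u 0 … u (2k − 1) whose halves are coloured alike: by rigidity of f
  -- the halves agree on the diagonal coordinate, so the y-coordinates of the halves
  -- move in parallel and differ by a constant m; if m ≠ 0, g would contain a square.
  module RepeatedWalk (k : ℕ) (u : ℕ → ℤ × ℤ) (1≤k : 1 ≤ℕ k)
                      (adj : ∀ i → suc i <ℕ k +ℕ k → Adj (P □ P) (u i) (u (suc i)))
                      (repeats : ∀ i → i <ℕ k → colour (u i) ≡ colour (u (k +ℕ i))) where

    x y s : ℕ → ℤ
    x i = proj₁ (u i)
    y i = proj₂ (u i)
    s i = x i + y i

    e : ℕ → Direction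
    e i = direction (s i) (s (suc i))

    moves : ∀ i → suc i <ℕ k +ℕ k → (s (suc i) ≡ s i + ⟦ e i ⟧) × (y (suc i) ≡ y i ⊎ y (suc i) ≡ y i + ⟦ e i ⟧)
    moves i b with grid-step (adj i b)
    ... | d , s′ , y′ = subst (λ d′ → (s (suc i) ≡ s i + ⟦ d′ ⟧) × (y (suc i) ≡ y i ⊎ y (suc i) ≡ y i + ⟦ d′ ⟧))
                              (sym (direction-unique s′)) (s′ , y′)

    diagonal : ∀ i → i <ℕ k → s (k +ℕ i) ≡ s i
    diagonal = walk-rigidity k s e 1≤k (λ i b → proj₁ (moves i b)) (λ i i<k → cong proj₁ (repeats i i<k))

    vertical : ∀ i → i <ℕ k → g (y i) ≡ g (y (k +ℕ i))
    vertical i i<k = cong proj₂ (repeats i i<k)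

    same-directions : ∀ j → suc j <ℕ k → e (k +ℕ j) ≡ e j
    same-directions j sj<k = ⟦⟧-injective (+-cancelˡ (s j) (begin
      s j + ⟦ e (k +ℕ j) ⟧            ≡⟨ cong (_+ ⟦ e (k +ℕ j) ⟧) (sym (diagonal j j<k)) ⟩
      s (k +ℕ j) + ⟦ e (k +ℕ j) ⟧     ≡⟨ sym (proj₁ (moves (k +ℕ j) (second-half sj<k))) ⟩
      s (suc (k +ℕ j))                ≡⟨ cong s (sym (ℕ.+-suc k j)) ⟩
      s (k +ℕ suc j)                  ≡⟨ diagonal (suc j) sj<k ⟩
      s (suc j)                       ≡⟨ proj₁ (moves j (first-half j<k)) ⟩
      s j + ⟦ e j ⟧                   ∎))
      where
      open ≡-Reasoning
      j<k : j <ℕ k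
      j<k = ℕ.<⇒≤ sj<k

    m : ℤ
    m = y (k +ℕ 0) - y 0

    vertical-shift : ∀ j → j <ℕ k → y (k +ℕ j) ≡ y j + m
    vertical-shift zero _ = arith (y (k +ℕ 0)) (y 0)
      where arith : ∀ a b → a ≡ b + (a - b)
            arith = solve-∀
    vertical-shift (suc j) sj<k with proj₂ (moves j (first-half (ℕ.<⇒≤ sj<k))) | proj₂ (moves (k +ℕ j) (second-half sj<k))
    ... | inj₁ stay | inj₁ stay′ = trans (cong y (ℕ.+-suc k j)) (trans stay′ (trans (vertical-shift j (ℕ.<⇒≤ sj<k)) (cong (_+ m) (sym stay))))
    ... | inj₂ go | inj₂ go′ = trans (cong y (ℕ.+-suc k j))
        (trans go′ (trans (cong₂ _+_ (vertical-shift j (ℕ.<⇒≤ sj<k)) (cong ⟦_⟧ (same-directions j sj<k)))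
          (trans (arith (y j) m ⟦ e j ⟧) (cong (_+ m) (sym go)))))
      where
      arith : ∀ a d x → a + d + x ≡ a + x + d
      arith = solve-∀
    ... | inj₁ stay | inj₂ go′ = ⊥-elim (squareFree-neighbours {f = g} g-squareFree (y (k +ℕ j)) (e (k +ℕ j))
        (trans (sym (vertical j (ℕ.<⇒≤ sj<k))) (trans (cong g (sym stay)) (trans (vertical (suc j) sj<k) (cong g (trans (cong y (ℕ.+-suc k j)) go′))))))
    ... | inj₂ go | inj₁ stay′ = ⊥-elim (squareFree-neighbours {f = g} g-squareFree (y j) (e j)
        (trans (vertical j (ℕ.<⇒≤ sj<k)) (trans (cong g (sym stay′)) (trans (cong (g ∘ y) (sym (ℕ.+-suc k j))) (trans (sym (vertical (suc j) sj<k)) (cong g go))))))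

    halves-coincide : u 0 ≡ u (k +ℕ 0)
    halves-coincide with m ℤ.≟ 0ℤ
    ... | yes m≡0 = sym (cong₂ _,_ x-back y-back)
      where
      y-back : y (k +ℕ 0) ≡ y 0
      y-back = trans (vertical-shift 0 1≤k) (trans (cong (λ z → y 0 + z) m≡0) (ℤ.+-identityʳ (y 0)))
      arith : ∀ a b → a ≡ a + b - b
      arith = solve-∀
      x-back : x (k +ℕ 0) ≡ x 0
      x-back = trans (arith (x (k +ℕ 0)) (y (k +ℕ 0))) (trans (cong₂ _-_ (diagonal 0 1≤k) y-back) (sym (arith (x 0) (y 0))))
    ... | no m≢0 = ⊥-elim (lazy-walk-translation {f = g} g-squareFree k y lazy m m≢0
                     (trans (cong y (sym (ℕ.+-identityʳ k))) (vertical-shift 0 1≤k))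
                     (λ i i<k → trans (vertical i i<k) (cong g (vertical-shift i i<k))))
      where
      lazy : LazyWalk k y
      lazy i i<k with proj₂ (moves i (first-half i<k))
      ... | inj₁ stay = inj₁ stay
      ... | inj₂ go = inj₂ (e i , go)

  colour-nonRepetitive : NonRepetitive (P □ P) colour
  colour-nonRepetitive zero () _ _ _ _
  colour-nonRepetitive (suc k′) _ [] () _ _
  colour-nonRepetitive (suc k′) 1≤k (v ∷ vs′) len (walk , (v∉vs′ ∷ _)) same =
    nth-All origin v∉vs′ (k′ +ℕ 0) (subst (k′ +ℕ 0 <ℕ_) (sym (ℕ.suc-injective len)) (ℕ.+-monoʳ-< k′ (s≤s z≤n)))
      (RepeatedWalk.halves-coincide k u 1≤k adj repeats)
    where
    origin : ℤ × ℤ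
    origin = 0ℤ , 0ℤ
    k : ℕ
    k = suc k′
    vs : List (ℤ × ℤ)
    vs = v ∷ vs′
    u : ℕ → ℤ × ℤ
    u = nth origin vs
    adj : ∀ i → suc i <ℕ k +ℕ k → Adj (P □ P) (u i) (u (suc i))
    adj i b = nth-Walk walk origin i (subst (suc i <ℕ_) (trans (cong (k +ℕ_) (sym (ℕ.+-identityʳ k))) (sym len)) b)
    repeats : ∀ i → i <ℕ k → colour (u i) ≡ colour (u (k +ℕ i))
    repeats i i<k = begin
      colour (u i)                                   ≡⟨ cong colour (sym (nth-take origin k vs i i<k)) ⟩
      colour (nth origin (take k vs) i)              ≡⟨ sym (nth-map origin colour (take k vs) i) ⟩
      nth (colour origin) (map colour (take k vs)) i ≡⟨ cong (λ l → nth (colour origin) l i) same ⟩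
      nth (colour origin) (map colour (drop k vs)) i ≡⟨ nth-map origin colour (drop k vs) i ⟩
      colour (nth origin (drop k vs) i)              ≡⟨ cong colour (nth-drop origin k vs i) ⟩
      colour (u (k +ℕ i))                            ∎
      where open ≡-Reasoning

-- Base-4 digit recursions

remainder-first : ∀ d r q → r + q * d ≡ d * q + r
remainder-first = solve-∀

even-or-odd : ∀ n → ∃ λ q → (n ≡ + 2 * q) ⊎ (n ≡ + 2 * q + 1ℤ)
even-or-odd n with n %ℕ 2 | n%ℕd<d n 2 | a≡a%ℕn+[a/ℕn]*n n 2
... | 0 | _ | e = n /ℕ 2 , inj₁ (trans e (trans (remainder-first (+ 2) (+ 0) (n /ℕ 2)) (ℤ.+-identityʳ _)))
... | 1 | _ | e = n /ℕ 2 , inj₂ (trans e (remainder-first (+ 2) 1ℤ (n /ℕ 2)))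
... | suc (suc _) | s≤s (s≤s ()) | _

data Digit : Set where
  d0 d1 d2 d3 : Digit

value : Digit → ℕ
value d0 = 0
value d1 = 1
value d2 = 2
value d3 = 3

complement : Digit → Digit
complement d0 = d3
complement d1 = d2
complement d2 = d1
complement d3 = d0

highBit : Digit → Bool
highBit d0 = false
highBit d1 = false
highBit d2 = true
highBit d3 = true

quotient-digit : ∀ n → ∃₂ λ q r → n ≡ + 4 * q + + value r
quotient-digit n with n %ℕ 4 | n%ℕd<d n 4 | a≡a%ℕn+[a/ℕn]*n n 4
... | 0 | _ | e = n /ℕ 4 , d0 , trans e (remainder-first (+ 4) (+ 0) (n /ℕ 4))
... | 1 | _ | e = n /ℕ 4 , d1 , trans e (remainder-first (+ 4) (+ 1) (n /ℕ 4))
... | 2 | _ | e = n /ℕ 4 , d2 , trans e (remainder-first (+ 4) (+ 2) (n /ℕ 4))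
... | 3 | _ | e = n /ℕ 4 , d3 , trans e (remainder-first (+ 4) (+ 3) (n /ℕ 4))
... | suc (suc (suc (suc _))) | s≤s (s≤s (s≤s (s≤s ()))) | _

divMod4 : ℕ → ℕ × Digit
divMod4 0 = 0 , d0
divMod4 1 = 0 , d1
divMod4 2 = 0 , d2
divMod4 3 = 0 , d3
divMod4 (suc (suc (suc (suc n)))) = suc (proj₁ (divMod4 n)) , proj₂ (divMod4 n)

divMod4-correct : ∀ q r → divMod4 (q *ℕ 4 +ℕ value r) ≡ (q , r)
divMod4-correct zero d0 = refl
divMod4-correct zero d1 = refl
divMod4-correct zero d2 = refl
divMod4-correct zero d3 = refl
divMod4-correct (suc q) r rewrite divMod4-correct q r = refl

divMod4-sound : ∀ n → n ≡ proj₁ (divMod4 n) *ℕ 4 +ℕ value (proj₂ (divMod4 n))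
divMod4-sound 0 = refl
divMod4-sound 1 = refl
divMod4-sound 2 = refl
divMod4-sound 3 = refl
divMod4-sound (suc (suc (suc (suc n)))) = cong (λ m → suc (suc (suc (suc m)))) (divMod4-sound n)

quotient-≤ : ∀ n → proj₁ (divMod4 n) ≤ℕ n
quotient-≤ 0 = z≤n
quotient-≤ 1 = z≤n
quotient-≤ 2 = z≤n
quotient-≤ 3 = z≤n
quotient-≤ (suc (suc (suc (suc n)))) = s≤s (ℕ.≤-trans (quotient-≤ n) (ℕ.m≤n+m n 3))

quotient-< : ∀ n → proj₁ (divMod4 (suc n)) <ℕ suc n
quotient-< 0 = s≤s z≤n
quotient-< 1 = s≤s z≤n
quotient-< 2 = s≤s z≤n
quotient-< (suc (suc (suc n))) = s≤s (s≤s (ℕ.≤-trans (quotient-≤ n) (ℕ.m≤n+m n 2)))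

-- A Boolean sequence on ℕ given by R (4q + r) = step r q (R q).  It is computed
-- with fuel; the recursion equation holds as soon as the fuel exceeds the argument.
module DigitRecursion (step : Digit → ℕ → Bool → Bool) (step-0 : step d0 0 false ≡ false) where

  private
    run : ℕ → ℕ → Bool
    run zero n = false
    run (suc f) n = step (proj₂ (divMod4 n)) (proj₁ (divMod4 n)) (run f (proj₁ (divMod4 n)))

    run-0 : ∀ f → run f 0 ≡ false
    run-0 zero = refl
    run-0 (suc f) rewrite run-0 f = step-0

    run-stable : ∀ f g n → n <ℕ f → n <ℕ g → run f n ≡ run g n
    run-stable f g zero _ _ = trans (run-0 f) (sym (run-0 g))
    run-stable (suc f) (suc g) (suc n) (s≤s n<f) (s≤s n<g) =
      cong (step (proj₂ (divMod4 (suc n))) (proj₁ (divMod4 (suc n))))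
        (run-stable f g _ (ℕ.<-≤-trans (quotient-< n) n<f) (ℕ.<-≤-trans (quotient-< n) n<g))

  seq : ℕ → Bool
  seq n = run (suc n) n

  seq-digit : ∀ q r → seq (q *ℕ 4 +ℕ value r) ≡ step r q (seq q)
  seq-digit q r = begin
    run (suc n) n                          ≡⟨ cong (λ (qr : ℕ × Digit) → step (proj₂ qr) (proj₁ qr) (run n (proj₁ qr)))
                                                   (divMod4-correct q r) ⟩
    step r q (run n q)                     ≡⟨ cong (step r q) (stable q r) ⟩
    step r q (seq q)                       ∎
    where
    open ≡-Reasoning
    n : ℕ
    n = q *ℕ 4 +ℕ value r
    stable : ∀ q r → run (q *ℕ 4 +ℕ value r) q ≡ seq q
    stable zero r = trans (run-0 (value r)) (sym (run-0 1))
    stable (suc q) r = run-stable _ _ _ (s≤s (s≤s (ℕ.≤-trans (ℕ.≤-trans (ℕ.m≤m*n q 4) (ℕ.m≤m+n _ (value r))) (ℕ.m≤n+m _ 2)))) (ℕ.n<1+n _)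

+4*+q+r : ∀ m r → + 4 * + m + + value r ≡ + (m *ℕ 4 +ℕ value r)
+4*+q+r m r = sym (trans (ℤ.pos-+ (m *ℕ 4) (value r)) (cong (_+ + value r) (trans (ℤ.pos-* m 4) (ℤ.*-comm (+ m) (+ 4)))))

+4*-q+r : ∀ m r → + 4 * -[1+ m ] + + value r ≡ -[1+ (m *ℕ 4 +ℕ value (complement r)) ]
+4*-q+r m r = begin
  + 4 * -[1+ m ] + + value r                    ≡⟨ cong (λ z → + 4 * z + + value r) (neg m) ⟩
  + 4 * (-1ℤ - + m) + + value r                  ≡⟨ reflect r (+ m) ⟩
  -1ℤ - (+ 4 * + m + + value (complement r))    ≡⟨ cong (λ z → -1ℤ - z) (+4*+q+r m (complement r)) ⟩
  -1ℤ - + (m *ℕ 4 +ℕ value (complement r))      ≡⟨ sym (neg _) ⟩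
  -[1+ (m *ℕ 4 +ℕ value (complement r)) ]       ∎
  where
  open ≡-Reasoning
  neg : ∀ m → -[1+ m ] ≡ -1ℤ - + m
  neg zero = refl
  neg (suc m) = refl
  reflect : ∀ r x → + 4 * (-1ℤ - x) + + value r ≡ -1ℤ - (+ 4 * x + + value (complement r))
  reflect d0 = solve-∀
  reflect d1 = solve-∀
  reflect d2 = solve-∀
  reflect d3 = solve-∀

2[2q]≡4q+0 : ∀ q → + 2 * (+ 2 * q) ≡ + 4 * q + + 0
2[2q]≡4q+0 = solve-∀

2[2q]+1≡4q+1 : ∀ q → + 2 * (+ 2 * q) + 1ℤ ≡ + 4 * q + + 1
2[2q]+1≡4q+1 = solve-∀

2[2q+1]≡4q+2 : ∀ q → + 2 * (+ 2 * q + 1ℤ) ≡ + 4 * q + + 2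
2[2q+1]≡4q+2 = solve-∀

2[2q+1]+1≡4q+3 : ∀ q → + 2 * (+ 2 * q + 1ℤ) + 1ℤ ≡ + 4 * q + + 3
2[2q+1]+1≡4q+3 = solve-∀

-- The Thue–Morse word and a square-free ternary word

parityℕ : ℕ → Bool
parityℕ zero = false
parityℕ (suc m) = not (parityℕ m)

parityℕ-double : ∀ l → parityℕ (l +ℕ l) ≡ false
parityℕ-double zero = refl
parityℕ-double (suc l) rewrite ℕ.+-suc l l = trans (not-involutive _) (parityℕ-double l)

parity : ℤ → Bool
parity (+ m) = parityℕ m
parity -[1+ m ] = not (parityℕ m)

parity-suc : ∀ n → parity (n + 1ℤ) ≡ not (parity n)
parity-suc (+ m) = cong parityℕ (ℕ.+-comm m 1)
parity-suc -[1+ zero ] = refl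
parity-suc -[1+ suc m ] = sym (not-involutive _)

+-suc-ℤ : ∀ p i → p + + suc i ≡ p + + i + 1ℤ
+-suc-ℤ p i = shift p (+ i)
  where shift : ∀ p x → p + (1ℤ + x) ≡ p + x + 1ℤ
        shift = solve-∀

+-suc-+ : ∀ p i L → p + + suc i + + L ≡ p + + i + + L + 1ℤ
+-suc-+ p i L = shift p (+ i) (+ L)
  where shift : ∀ p x y → p + (1ℤ + x) + y ≡ p + x + y + 1ℤ
        shift = solve-∀

-- X is a concatenation of the blocks 01 and 10 (aligned at even positions).
ComplementaryPairs : (ℤ → Bool) → Set
ComplementaryPairs X = ∀ n → X (+ 2 * n + 1ℤ) ≡ not (X (+ 2 * n))

module _ {X : ℤ → Bool} (pairs : ComplementaryPairs X) where

  -- An odd shift exchanges the two positions of a block, so X alternates on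
  -- the whole overlap and X (p + L) = not (X p).
  odd-overlap-impossible : ∀ p l → ¬ Overlap X p (suc (l +ℕ l))
  odd-overlap-impossible p l ov = not-¬ refl (begin
      X p                       ≡⟨ cong X (sym (ℤ.+-identityʳ p)) ⟩
      X (p + + 0)               ≡⟨ ov 0 z≤n ⟩
      X (p + + 0 + + L)          ≡⟨ cong (λ z → X (z + + L)) (ℤ.+-identityʳ p) ⟩
      X (p + + L)                ≡⟨ alternating L ℕ.≤-refl ⟩
      X p xor parityℕ L          ≡⟨ cong (λ b → X p xor not b) (parityℕ-double l) ⟩
      X p xor true               ≡⟨ xor-comm (X p) true ⟩
      not (X p)                  ∎)
    where
    open ≡-Reasoning
    L : ℕ
    L = suc (l +ℕ l)
    step : ∀ i → i <ℕ L → X (p + + suc i) ≡ not (X (p + + i))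
    step i i<L with even-or-odd (p + + i)
    ... | a , inj₁ e = trans (cong X (trans (+-suc-ℤ p i) (cong (_+ 1ℤ) e))) (trans (pairs a) (cong (not ∘ X) (sym e)))
    ... | a , inj₂ e = begin
      X (p + + suc i)               ≡⟨ ov (suc i) i<L ⟩
      X (p + + suc i + + L)         ≡⟨ cong X (trans (+-suc-+ p i L) (cong (_+ 1ℤ) shifted)) ⟩
      X (+ 2 * b + 1ℤ)              ≡⟨ pairs b ⟩
      not (X (+ 2 * b))             ≡⟨ cong (not ∘ X) (sym shifted) ⟩
      not (X (p + + i + + L))       ≡⟨ cong not (sym (ov i (ℕ.<⇒≤ i<L))) ⟩
      not (X (p + + i))             ∎
      where
      b : ℤ
      b = a + + l + 1ℤ
      arith : ∀ a x → + 2 * a + 1ℤ + (1ℤ + (x + x)) ≡ + 2 * (a + x + 1ℤ)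
      arith = solve-∀
      shifted : p + + i + + L ≡ + 2 * b
      shifted = trans (cong (_+ + L) e) (trans (cong (λ z → + 2 * a + 1ℤ + (1ℤ + z)) (ℤ.pos-+ l l)) (arith a (+ l)))
    alternating : ∀ i → i ≤ℕ L → X (p + + i) ≡ X p xor parityℕ i
    alternating zero _ = trans (cong X (ℤ.+-identityʳ p)) (sym (xor-identityʳ (X p)))
    alternating (suc i) i<L = begin
      X (p + + suc i)            ≡⟨ step i i<L ⟩
      not (X (p + + i))          ≡⟨ cong not (alternating i (ℕ.<⇒≤ i<L)) ⟩
      not (X p xor parityℕ i)    ≡⟨ not-distribʳ-xor (X p) (parityℕ i) ⟩
      X p xor parityℕ (suc i)    ∎

  even-overlap-halves : ∀ {Y : ℤ → Bool} → (∀ n → Y n ≡ X (+ 2 * n)) →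
                        ∀ p m → Overlap X p (m +ℕ m) → ∃ λ q → Overlap Y q m
  even-overlap-halves {Y} Y-even p m ov with even-or-odd p
  ... | q , inj₁ e = q , λ j j≤m → begin
    Y (q + + j)                    ≡⟨ Y-even _ ⟩
    X (+ 2 * (q + + j))            ≡⟨ cong X (aligned j) ⟩
    X (p + + (j +ℕ j))             ≡⟨ ov (j +ℕ j) (ℕ.+-mono-≤ j≤m j≤m) ⟩
    X (p + + (j +ℕ j) + + (m +ℕ m)) ≡⟨ cong X (sym (aligned+ j)) ⟩
    X (+ 2 * (q + + j + + m))      ≡⟨ sym (Y-even _) ⟩
    Y (q + + j + + m)              ∎
    where
    open ≡-Reasoning
    arith : ∀ q x → + 2 * (q + x) ≡ + 2 * q + (x + x)
    arith = solve-∀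
    arith+ : ∀ q x y → + 2 * (q + x + y) ≡ + 2 * q + (x + x) + (y + y)
    arith+ = solve-∀
    aligned : ∀ j → + 2 * (q + + j) ≡ p + + (j +ℕ j)
    aligned j = trans (arith q (+ j)) (sym (trans (cong (_+ + (j +ℕ j)) e) (cong (λ z → + 2 * q + z) (ℤ.pos-+ j j))))
    aligned+ : ∀ j → + 2 * (q + + j + + m) ≡ p + + (j +ℕ j) + + (m +ℕ m)
    aligned+ j = trans (arith+ q (+ j) (+ m)) (sym (trans (cong (λ z → z + + (j +ℕ j) + + (m +ℕ m)) e)
                   (cong₂ (λ u v → + 2 * q + u + v) (ℤ.pos-+ j j) (ℤ.pos-+ m m))))
  ... | q , inj₂ e = q , λ j j≤m → begin
    Y (q + + j)                          ≡⟨ Y-even _ ⟩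
    X (+ 2 * (q + + j))                  ≡⟨ partner _ ⟩
    not (X (+ 2 * (q + + j) + 1ℤ))       ≡⟨ cong (λ z → not (X z)) (aligned j) ⟩
    not (X (p + + (j +ℕ j)))             ≡⟨ cong not (ov (j +ℕ j) (ℕ.+-mono-≤ j≤m j≤m)) ⟩
    not (X (p + + (j +ℕ j) + + (m +ℕ m))) ≡⟨ cong (λ z → not (X z)) (sym (aligned+ j)) ⟩
    not (X (+ 2 * (q + + j + + m) + 1ℤ)) ≡⟨ sym (partner _) ⟩
    X (+ 2 * (q + + j + + m))            ≡⟨ sym (Y-even _) ⟩
    Y (q + + j + + m)                    ∎
    where
    open ≡-Reasoning
    partner : ∀ n → X (+ 2 * n) ≡ not (X (+ 2 * n + 1ℤ))
    partner n = trans (sym (not-involutive _)) (cong not (sym (pairs n)))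
    arith : ∀ q x → + 2 * (q + x) + 1ℤ ≡ + 2 * q + 1ℤ + (x + x)
    arith = solve-∀
    arith+ : ∀ q x y → + 2 * (q + x + y) + 1ℤ ≡ + 2 * q + 1ℤ + (x + x) + (y + y)
    arith+ = solve-∀
    aligned : ∀ j → + 2 * (q + + j) + 1ℤ ≡ p + + (j +ℕ j)
    aligned j = trans (arith q (+ j)) (sym (trans (cong (_+ + (j +ℕ j)) e) (cong (λ z → + 2 * q + 1ℤ + z) (ℤ.pos-+ j j))))
    aligned+ : ∀ j → + 2 * (q + + j + + m) + 1ℤ ≡ p + + (j +ℕ j) + + (m +ℕ m)
    aligned+ j = trans (arith+ q (+ j) (+ m)) (sym (trans (cong (λ z → z + + (j +ℕ j) + + (m +ℕ m)) e)
                   (cong₂ (λ u v → + 2 * q + 1ℤ + u + v) (ℤ.pos-+ j j) (ℤ.pos-+ m m))))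

ℕ-even-or-odd : ∀ m → ∃ λ t → (m ≡ t +ℕ t) ⊎ (m ≡ suc (t +ℕ t))
ℕ-even-or-odd zero = 0 , inj₁ refl
ℕ-even-or-odd (suc m) with ℕ-even-or-odd m
... | t , inj₁ e = t , inj₂ (cong suc e)
... | t , inj₂ e = suc t , inj₁ (trans (cong suc e) (cong suc (sym (ℕ.+-suc t t))))

-- Each base-4 digit r flips the Thue–Morse value iff r has one binary digit 1.
thueMorseStep : Digit → Bool → Bool
thueMorseStep d0 b = b
thueMorseStep d1 b = not b
thueMorseStep d2 b = not b
thueMorseStep d3 b = b

module ThueMorseℕ = DigitRecursion (λ r _ → thueMorseStep r) refl

thueMorse : ℤ → Bool
thueMorse (+ m) = ThueMorseℕ.seq m
thueMorse -[1+ m ] = ThueMorseℕ.seq m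

thueMorse-digit : ∀ q r → thueMorse (+ 4 * q + + value r) ≡ thueMorseStep r (thueMorse q)
thueMorse-digit (+ m) r rewrite +4*+q+r m r = ThueMorseℕ.seq-digit m r
thueMorse-digit -[1+ m ] r rewrite +4*-q+r m r = trans (ThueMorseℕ.seq-digit m (complement r)) (symmetric r)
  where symmetric : ∀ r → thueMorseStep (complement r) (ThueMorseℕ.seq m) ≡ thueMorseStep r (ThueMorseℕ.seq m)
        symmetric d0 = refl
        symmetric d1 = refl
        symmetric d2 = refl
        symmetric d3 = refl

-- thueMorse at even positions; it equals thueMorse, but only the two
-- properties below are needed.
thueMorse₂ : ℤ → Bool
thueMorse₂ n = thueMorse (+ 2 * n)

thueMorse-pairs : ComplementaryPairs thueMorse
thueMorse-pairs n with even-or-odd n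
... | q , inj₁ refl rewrite 2[2q]+1≡4q+1 q | 2[2q]≡4q+0 q =
  trans (thueMorse-digit q d1) (cong not (sym (thueMorse-digit q d0)))
... | q , inj₂ refl rewrite 2[2q+1]+1≡4q+3 q | 2[2q+1]≡4q+2 q =
  trans (thueMorse-digit q d3) (trans (sym (not-involutive _)) (cong not (sym (thueMorse-digit q d2))))

thueMorse₂-even : ∀ n → thueMorse₂ (+ 2 * n) ≡ thueMorse n
thueMorse₂-even n = trans (cong thueMorse (2[2q]≡4q+0 n)) (thueMorse-digit n d0)

thueMorse₂-pairs : ComplementaryPairs thueMorse₂
thueMorse₂-pairs n = trans (cong thueMorse (2[2q+1]≡4q+2 n)) (trans (thueMorse-digit n d2) (cong not (sym (thueMorse₂-even n))))

-- An overlap of length 4m in thueMorse yields one of length m, via thueMorse₂.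
thueMorse-overlapFree : OverlapFree thueMorse
thueMorse-overlapFree p L = <-rec (λ L → ∀ p → 1 ≤ℕ L → ¬ Overlap thueMorse p L) descend L p
  where
  descend : ∀ L → (∀ {L'} → L' <ℕ L → ∀ p → 1 ≤ℕ L' → ¬ Overlap thueMorse p L') →
            ∀ p → 1 ≤ℕ L → ¬ Overlap thueMorse p L
  descend L ih p 1≤L ov with ℕ-even-or-odd L
  ... | l , inj₂ refl = odd-overlap-impossible {thueMorse} thueMorse-pairs p l ov
  ... | m , inj₁ refl with even-overlap-halves {thueMorse} thueMorse-pairs {thueMorse₂} (λ _ → refl) p m ov
  ...   | q , ov₂ with ℕ-even-or-odd m
  ...     | l , inj₂ refl = odd-overlap-impossible {thueMorse₂} thueMorse₂-pairs q l ov₂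
  ...     | m' , inj₁ refl with even-overlap-halves {thueMorse₂} thueMorse₂-pairs {thueMorse} (λ n → sym (thueMorse₂-even n)) q m' ov₂
  ...       | q' , ov' = ih (quarter-< m' 1≤L) q' (quarter-≥1 m' 1≤L) ov'
    where
    quarter-≥1 : ∀ m → 1 ≤ℕ (m +ℕ m) +ℕ (m +ℕ m) → 1 ≤ℕ m
    quarter-≥1 (suc _) _ = s≤s z≤n
    quarter-< : ∀ m → 1 ≤ℕ (m +ℕ m) +ℕ (m +ℕ m) → m <ℕ (m +ℕ m) +ℕ (m +ℕ m)
    quarter-< (suc m) _ = ℕ.<-≤-trans (ℕ.m<m+n (suc m) (s≤s z≤n)) (ℕ.m≤m+n _ _)

difference : Bool → Bool → Fin 3
difference false false = sucF 0F
difference true true = sucF 0F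
difference false true = sucF (sucF 0F)
difference true false = 0F

difference-first : ∀ {a b a' b'} → a ≡ a' → difference a b ≡ difference a' b' → b ≡ b'
difference-first {false} {false} {b' = false} refl _ = refl
difference-first {false} {true} {b' = true} refl _ = refl
difference-first {true} {false} {b' = false} refl _ = refl
difference-first {true} {true} {b' = true} refl _ = refl
difference-first {false} {false} {b' = true} refl ()
difference-first {false} {true} {b' = false} refl ()
difference-first {true} {false} {b' = true} refl ()
difference-first {true} {true} {b' = false} refl ()

difference-opposite : ∀ {a b a' b'} → a' ≡ not a → difference a b ≡ difference a' b' → (b ≡ a) × (b' ≡ a')
difference-opposite {false} {false} {b' = true} refl _ = refl , refl
difference-opposite {true} {true} {b' = false} refl _ = refl , refl
difference-opposite {false} {false} {b' = false} refl ()
difference-opposite {false} {true} {b' = false} refl ()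
difference-opposite {false} {true} {b' = true} refl ()
difference-opposite {true} {false} {b' = false} refl ()
difference-opposite {true} {false} {b' = true} refl ()
difference-opposite {true} {true} {b' = true} refl ()

ternaryThueMorse : ℤ → Fin 3
ternaryThueMorse n = difference (thueMorse n) (thueMorse (n + 1ℤ))

-- A square of length L in the differences starting with equal values of thueMorse
-- lifts to an overlap of thueMorse; starting with opposite values, it forces thueMorse
-- to be constant on both halves, so the two values would have to agree after all.
ternaryThueMorse-squareFree : SquareFree ternaryThueMorse
ternaryThueMorse-squareFree p L 1≤L sq with thueMorse p ≟ᵇ thueMorse (p + + L)
... | yes e = thueMorse-overlapFree p L 1≤L lifted
  where
  lifted : Overlap thueMorse p L
  lifted zero _ = trans (cong thueMorse (ℤ.+-identityʳ p)) (trans e (cong (λ z → thueMorse (z + + L)) (sym (ℤ.+-identityʳ p))))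
  lifted (suc i) i<L = trans (cong thueMorse (+-suc-ℤ p i))
    (trans (difference-first (lifted i (ℕ.<⇒≤ i<L)) (sq i i<L)) (cong thueMorse (sym (+-suc-+ p i L))))
... | no ne = ne (sym (proj₁ (constant L ℕ.≤-refl)))
  where
  constant : ∀ i → i ≤ℕ L → (thueMorse (p + + i) ≡ thueMorse p) × (thueMorse (p + + i + + L) ≡ not (thueMorse p))
  constant zero _ = cong thueMorse (ℤ.+-identityʳ p) , trans (cong (λ z → thueMorse (z + + L)) (ℤ.+-identityʳ p)) (¬-not (ne ∘ sym))
  constant (suc i) i<L with constant i (ℕ.<⇒≤ i<L)
  ... | left , right with difference-opposite (trans right (cong not (sym left))) (sq i i<L)
  ... | left' , right' = trans (cong thueMorse (+-suc-ℤ p i)) (trans left' left) ,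
                         trans (cong thueMorse (+-suc-+ p i L)) (trans right' right)

-- A square-free word on four letters without factors aba

halfParityℕ : ℕ → Bool
halfParityℕ zero = false
halfParityℕ (suc zero) = false
halfParityℕ (suc (suc m)) = not (halfParityℕ m)

halfParity : ℤ → Bool
halfParity (+ m) = halfParityℕ m
halfParity -[1+ m ] = not (halfParityℕ m)

halfParityℕ-digit : ∀ m r → halfParityℕ (m *ℕ 4 +ℕ value r) ≡ highBit r
halfParityℕ-digit zero d0 = refl
halfParityℕ-digit zero d1 = refl
halfParityℕ-digit zero d2 = refl
halfParityℕ-digit zero d3 = refl
halfParityℕ-digit (suc m) r = trans (not-involutive _) (halfParityℕ-digit m r)

halfParityℕ-double : ∀ m → halfParityℕ (m +ℕ m) ≡ parityℕ m
halfParityℕ-double zero = refl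
halfParityℕ-double (suc m) rewrite ℕ.+-suc m m = cong not (halfParityℕ-double m)

halfParityℕ-double+1 : ∀ m → halfParityℕ (suc (m +ℕ m)) ≡ parityℕ m
halfParityℕ-double+1 zero = refl
halfParityℕ-double+1 (suc m) rewrite ℕ.+-suc m m = cong not (halfParityℕ-double+1 m)

2q≡q+q : ∀ q → + 2 * q ≡ q + q
2q≡q+q = solve-∀

halfParity-2q : ∀ q → halfParity (+ 2 * q) ≡ parity q
halfParity-2q q rewrite 2q≡q+q q = double q
  where
  double : ∀ q → halfParity (q + q) ≡ parity q
  double (+ m) = halfParityℕ-double m
  double -[1+ m ] = cong not (halfParityℕ-double+1 m)

halfParity-2q+1 : ∀ q → halfParity (+ 2 * q + 1ℤ) ≡ parity q
halfParity-2q+1 q rewrite 2q≡q+q q = double+1 q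
  where
  double+1 : ∀ q → halfParity (q + q + 1ℤ) ≡ parity q
  double+1 (+ m) = trans (cong halfParityℕ (ℕ.+-comm (m +ℕ m) 1)) (halfParityℕ-double+1 m)
  double+1 -[1+ m ] = cong not (halfParityℕ-double m)

halfParity-+2 : ∀ n → halfParity (n + + 2) ≡ not (halfParity n)
halfParity-+2 n with even-or-odd n
... | q , inj₁ refl = begin
  halfParity (+ 2 * q + + 2)          ≡⟨ cong halfParity (arith q) ⟩
  halfParity (+ 2 * (q + 1ℤ))         ≡⟨ halfParity-2q (q + 1ℤ) ⟩
  parity (q + 1ℤ)                     ≡⟨ parity-suc q ⟩
  not (parity q)                      ≡⟨ cong not (sym (halfParity-2q q)) ⟩
  not (halfParity (+ 2 * q))          ∎
  where
  open ≡-Reasoning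
  arith : ∀ q → + 2 * q + + 2 ≡ + 2 * (q + 1ℤ)
  arith = solve-∀
... | q , inj₂ refl = begin
  halfParity (+ 2 * q + 1ℤ + + 2)     ≡⟨ cong halfParity (arith q) ⟩
  halfParity (+ 2 * (q + 1ℤ) + 1ℤ)    ≡⟨ halfParity-2q+1 (q + 1ℤ) ⟩
  parity (q + 1ℤ)                     ≡⟨ parity-suc q ⟩
  not (parity q)                      ≡⟨ cong not (sym (halfParity-2q+1 q)) ⟩
  not (halfParity (+ 2 * q + 1ℤ))     ∎
  where
  open ≡-Reasoning
  arith : ∀ q → + 2 * q + 1ℤ + + 2 ≡ + 2 * (q + 1ℤ) + 1ℤ
  arith = solve-∀

halfParity-+4M : ∀ M n → halfParity (n + + 4 * + M) ≡ halfParity n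
halfParity-+4M zero n = cong halfParity (arith n)
  where arith : ∀ n → n + + 4 * + 0 ≡ n
        arith = solve-∀
halfParity-+4M (suc M) n = begin
  halfParity (n + + 4 * + suc M)             ≡⟨ cong halfParity (arith n (+ M)) ⟩
  halfParity (n + + 4 * + M + + 2 + + 2)     ≡⟨ halfParity-+2 (n + + 4 * + M + + 2) ⟩
  not (halfParity (n + + 4 * + M + + 2))     ≡⟨ cong not (halfParity-+2 (n + + 4 * + M)) ⟩
  not (not (halfParity (n + + 4 * + M)))     ≡⟨ not-involutive _ ⟩
  halfParity (n + + 4 * + M)                 ≡⟨ halfParity-+4M M n ⟩
  halfParity n                               ∎
  where
  open ≡-Reasoning
  arith : ∀ n x → n + + 4 * (1ℤ + x) ≡ n + + 4 * x + + 2 + + 2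
  arith = solve-∀

-- Since halfParity has period 4 and flips under a shift by 2, no shift by a
-- non-multiple of 4 preserves it at two consecutive positions.
halfParity-shift : ∀ p L → halfParity p ≡ halfParity (p + + L) → halfParity (p + 1ℤ) ≡ halfParity (p + 1ℤ + + L) →
                   ∃ λ M → L ≡ 4 *ℕ M
halfParity-shift p L e₀ e₁ with divMod4 L | divMod4-sound L
... | M , r | refl = residue r (trans e₀ (reduce p)) (trans e₁ (reduce (p + 1ℤ)))
  where
  c : ℤ → Bool
  c = halfParity
  arith : ∀ p r M → p + (M * + 4 + r) ≡ p + r + + 4 * M
  arith = solve-∀
  reduce : ∀ p → c (p + + (M *ℕ 4 +ℕ value r)) ≡ c (p + + value r)
  reduce p = trans (cong c (trans (cong (λ z → p + z) (trans (ℤ.pos-+ _ (value r)) (cong (_+ + value r) (ℤ.pos-* M 4))))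
                                  (arith p (+ value r) (+ M))))
                   (halfParity-+4M M (p + + value r))
  plus : ∀ p → p + 1ℤ + 1ℤ ≡ p + + 2
  plus = solve-∀
  arith₃ : ∀ p → p + + 3 ≡ p + 1ℤ + + 2
  arith₃ = solve-∀
  arith₄ : ∀ p → p + 1ℤ + + 3 ≡ p + + 4 * + 1
  arith₄ = solve-∀
  residue : ∀ r → c p ≡ c (p + + value r) → c (p + 1ℤ) ≡ c (p + 1ℤ + + value r) →
            ∃ λ M' → M *ℕ 4 +ℕ value r ≡ 4 *ℕ M'
  residue d0 _ _ = M , trans (ℕ.+-identityʳ _) (ℕ.*-comm M 4)
  residue d1 e₀ e₁ = ⊥-elim (not-¬ refl (trans e₀ (trans e₁ (trans (cong c (plus p)) (halfParity-+2 p)))))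
  residue d2 e₀ _ = ⊥-elim (not-¬ refl (trans e₀ (halfParity-+2 p)))
  residue d3 e₀ e₁ = ⊥-elim (not-¬ refl (begin
    c (p + 1ℤ)               ≡⟨ e₁ ⟩
    c (p + 1ℤ + + 3)         ≡⟨ cong c (arith₄ p) ⟩
    c (p + + 4 * + 1)        ≡⟨ halfParity-+4M 1 p ⟩
    c p                      ≡⟨ e₀ ⟩
    c (p + + 3)              ≡⟨ cong c (arith₃ p) ⟩
    c (p + 1ℤ + + 2)         ≡⟨ halfParity-+2 (p + 1ℤ) ⟩
    not (c (p + 1ℤ))         ∎))
    where open ≡-Reasoning

βstep : Digit → Bool → Bool → Bool
βstep d0 x b = b
βstep d1 x b = not b
βstep d2 x b = b xor x
βstep d3 x b = not (b xor x)

module βℕ = DigitRecursion (λ r q b → βstep r (halfParityℕ q) b) refl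

-- On negative arguments β is chosen so that β (4q + r) = βstep r (halfParity q) (β q)
-- holds on all of ℤ.
β : ℤ → Bool
β (+ m) = βℕ.seq m
β -[1+ m ] = βℕ.seq m xor halfParityℕ m

β-digit : ∀ q r → β (+ 4 * q + + value r) ≡ βstep r (halfParity q) (β q)
β-digit (+ m) r rewrite +4*+q+r m r = βℕ.seq-digit m r
β-digit -[1+ m ] r rewrite +4*-q+r m r =
  trans (cong₂ _xor_ (βℕ.seq-digit m (complement r)) (halfParityℕ-digit m (complement r)))
        (reflect r (βℕ.seq m) (halfParityℕ m))
  where
  reflect : ∀ r b x → βstep (complement r) x b xor highBit (complement r) ≡ βstep r (not x) (b xor x)
  reflect d0 false false = refl
  reflect d0 false true = refl
  reflect d0 true false = refl
  reflect d0 true true = refl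
  reflect d1 false false = refl
  reflect d1 false true = refl
  reflect d1 true false = refl
  reflect d1 true true = refl
  reflect d2 false false = refl
  reflect d2 false true = refl
  reflect d2 true false = refl
  reflect d2 true true = refl
  reflect d3 false false = refl
  reflect d3 false true = refl
  reflect d3 true false = refl
  reflect d3 true true = refl

β-pairs : ComplementaryPairs β
β-pairs n with even-or-odd n
... | q , inj₁ refl rewrite 2[2q]+1≡4q+1 q | 2[2q]≡4q+0 q =
  trans (β-digit q d1) (cong not (sym (β-digit q d0)))
... | q , inj₂ refl rewrite 2[2q+1]+1≡4q+3 q | 2[2q+1]≡4q+2 q =
  trans (β-digit q d3) (cong not (sym (β-digit q d2)))

W : ℤ → Bool × Bool
W n = halfParity n , β n

W-+1 : ∀ p → W p ≢ W (p + 1ℤ)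
W-+1 p eq with even-or-odd p
... | a , inj₁ refl = not-¬ refl (trans (cong proj₂ eq) (β-pairs a))
... | a , inj₂ refl = not-¬ refl (begin
  parity a                        ≡⟨ sym (halfParity-2q+1 a) ⟩
  halfParity (+ 2 * a + 1ℤ)       ≡⟨ cong proj₁ eq ⟩
  halfParity (+ 2 * a + 1ℤ + 1ℤ)  ≡⟨ cong halfParity (arith a) ⟩
  halfParity (+ 2 * (a + 1ℤ))     ≡⟨ halfParity-2q (a + 1ℤ) ⟩
  parity (a + 1ℤ)                 ≡⟨ parity-suc a ⟩
  not (parity a)                  ∎)
  where
  open ≡-Reasoning
  arith : ∀ a → + 2 * a + 1ℤ + 1ℤ ≡ + 2 * (a + 1ℤ)
  arith = solve-∀

W-+2 : ∀ p → W p ≢ W (p + + 2)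
W-+2 p eq = not-¬ refl (trans (cong proj₁ eq) (halfParity-+2 p))

W-from-letters : ∀ {Q Q'} → β Q ≡ β Q' → β (+ 4 * Q + + 2) ≡ β (+ 4 * Q' + + 2) → W Q ≡ W Q'
W-from-letters {Q} {Q'} eβ e₂ = cong₂ _,_ (cancel {β Q} (begin
    β Q xor halfParity Q         ≡⟨ sym (β-digit Q d2) ⟩
    β (+ 4 * Q + + 2)            ≡⟨ e₂ ⟩
    β (+ 4 * Q' + + 2)           ≡⟨ β-digit Q' d2 ⟩
    β Q' xor halfParity Q'       ≡⟨ cong (_xor halfParity Q') (sym eβ) ⟩
    β Q xor halfParity Q'        ∎)) eβ
  where
  open ≡-Reasoning
  cancel : ∀ {b x x'} → b xor x ≡ b xor x' → x ≡ x'
  cancel {false} e = e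
  cancel {true} e = not-injective e

β-from-letter0 : ∀ {Q Q'} → β (+ 4 * Q + + 0) ≡ β (+ 4 * Q' + + 0) → β Q ≡ β Q'
β-from-letter0 {Q} {Q'} e = trans (sym (β-digit Q d0)) (trans e (β-digit Q' d0))

β-from-letter1 : ∀ {Q Q'} → β (+ 4 * Q + + 1) ≡ β (+ 4 * Q' + + 1) → β Q ≡ β Q'
β-from-letter1 {Q} {Q'} e = not-injective (trans (sym (β-digit Q d1)) (trans e (β-digit Q' d1)))

position : ∀ q x a b → + 4 * q + a + (+ 4 * x + b) ≡ + 4 * (q + x) + (a + b)
position = solve-∀

position-carry : ∀ q x a b → + 4 * q + a + (+ 4 * x + b) ≡ + 4 * (q + 1ℤ + x) + (a + b - + 4)
position-carry = solve-∀

position-next : ∀ q x a b → + 4 * q + a + (+ 4 * (1ℤ + x) + b) ≡ + 4 * (q + 1ℤ + x) + (a + b)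
position-next = solve-∀

-- A square of length 4M in W, read through the recursion β(4Q + r) = βstep r …,
-- gives a square of length M (or is impossible).
module Descent (q₀ : ℤ) (r₀ : Digit) (M : ℕ) (sq : Square W (+ 4 * q₀ + + value r₀) (4 *ℕ M)) where

  p : ℤ
  p = + 4 * q₀ + + value r₀

  letter-shift : ∀ j k Q r → j <ℕ M → k <ℕ 4 → p + (+ 4 * + j + + k) ≡ + 4 * Q + + value r →
                 β (+ 4 * Q + + value r) ≡ β (+ 4 * (Q + + M) + + value r)
  letter-shift j k Q r j<M k<4 pos = cong proj₂ (begin
    W (+ 4 * Q + + value r)              ≡⟨ cong W (sym pos′) ⟩
    W (p + + i)                          ≡⟨ sq i bound ⟩
    W (p + + i + + (4 *ℕ M))             ≡⟨ cong W (trans (cong₂ _+_ pos′ (ℤ.pos-* 4 M)) (arith Q (+ value r) (+ M))) ⟩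
    W (+ 4 * (Q + + M) + + value r)      ∎)
    where
    open ≡-Reasoning
    i : ℕ
    i = 4 *ℕ j +ℕ k
    pos′ : p + + i ≡ + 4 * Q + + value r
    pos′ = trans (cong (λ z → p + z) (trans (ℤ.pos-+ (4 *ℕ j) k) (cong (_+ + k) (ℤ.pos-* 4 j)))) pos
    arith : ∀ Q r m → + 4 * Q + r + + 4 * m ≡ + 4 * (Q + m) + r
    arith = solve-∀
    bound : i <ℕ 4 *ℕ M
    bound = ℕ.<-≤-trans (ℕ.+-monoʳ-< (4 *ℕ j) k<4)
              (ℕ.≤-trans (ℕ.≤-reflexive (trans (ℕ.+-comm (4 *ℕ j) 4) (sym (ℕ.*-suc 4 j)))) (ℕ.*-monoʳ-≤ 4 j<M))

  β-shift₀ : ∀ j k Q → j <ℕ M → k <ℕ 4 → p + (+ 4 * + j + + k) ≡ + 4 * Q + + 0 → β Q ≡ β (Q + + M)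
  β-shift₀ j k Q j<M k<4 pos = β-from-letter0 {Q} {Q + + M} (letter-shift j k Q d0 j<M k<4 pos)

  β-shift₁ : ∀ j k Q → j <ℕ M → k <ℕ 4 → p + (+ 4 * + j + + k) ≡ + 4 * Q + + 1 → β Q ≡ β (Q + + M)
  β-shift₁ j k Q j<M k<4 pos = β-from-letter1 {Q} {Q + + M} (letter-shift j k Q d1 j<M k<4 pos)

  W-shift : ∀ Q → β Q ≡ β (Q + + M) → β (+ 4 * Q + + 2) ≡ β (+ 4 * (Q + + M) + + 2) → W Q ≡ W (Q + + M)
  W-shift Q = W-from-letters {Q} {Q + + M}

  0<4 : 0 <ℕ 4
  0<4 = s≤s z≤n
  1<4 : 1 <ℕ 4
  1<4 = s≤s (s≤s z≤n)
  2<4 : 2 <ℕ 4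
  2<4 = s≤s (s≤s (s≤s z≤n))
  3<4 : 3 <ℕ 4
  3<4 = s≤s (s≤s (s≤s (s≤s z≤n)))

module _ (q₀ : ℤ) (M : ℕ) where

  descend-0 : Square W (+ 4 * q₀ + + 0) (4 *ℕ M) → Square W q₀ M
  descend-0 sq j j<M = W-shift (q₀ + + j)
    (β-shift₀ j 0 (q₀ + + j) j<M 0<4 (position q₀ (+ j) (+ 0) (+ 0)))
    (letter-shift j 2 (q₀ + + j) d2 j<M 2<4 (position q₀ (+ j) (+ 0) (+ 2)))
    where open Descent q₀ d0 M sq

  descend-1 : Square W (+ 4 * q₀ + + 1) (4 *ℕ M) → Square W q₀ M
  descend-1 sq j j<M = W-shift (q₀ + + j)
    (β-shift₁ j 0 (q₀ + + j) j<M 0<4 (position q₀ (+ j) (+ 1) (+ 0)))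
    (letter-shift j 1 (q₀ + + j) d2 j<M 1<4 (position q₀ (+ j) (+ 1) (+ 1)))
    where open Descent q₀ d1 M sq

  descend-3 : Square W (+ 4 * q₀ + + 3) (4 *ℕ M) → Square W (q₀ + 1ℤ) M
  descend-3 sq j j<M = W-shift (q₀ + 1ℤ + + j)
    (β-shift₀ j 1 (q₀ + 1ℤ + + j) j<M 1<4 (position-carry q₀ (+ j) (+ 3) (+ 1)))
    (letter-shift j 3 (q₀ + 1ℤ + + j) d2 j<M 3<4 (position-carry q₀ (+ j) (+ 3) (+ 3)))
    where open Descent q₀ d3 M sq

-- The factor W(4a + 2) … W(4a + 5) never repeats immediately.
short-square-impossible : ∀ a → β a xor halfParity a ≡ β (a + + 1) xor halfParity (a + + 1) → β (a + + 1) ≢ β (a + + 1 + + 1)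
short-square-impossible a letters shifted with even-or-odd a
... | t , inj₁ refl = not-¬ refl (begin
  β (+ 2 * t) xor halfParity (+ 2 * t)                   ≡⟨ letters ⟩
  β (+ 2 * t + 1ℤ) xor halfParity (+ 2 * t + 1ℤ)         ≡⟨ cong₂ _xor_ (β-pairs t) (trans (halfParity-2q+1 t) (sym (halfParity-2q t))) ⟩
  not (β (+ 2 * t)) xor halfParity (+ 2 * t)             ≡⟨ sym (not-distribˡ-xor (β (+ 2 * t)) (halfParity (+ 2 * t))) ⟩
  not (β (+ 2 * t) xor halfParity (+ 2 * t))             ∎)
  where open ≡-Reasoning
... | t , inj₂ refl = not-¬ refl (begin
  β (+ 2 * t + 1ℤ + + 1)               ≡⟨ cong β (arith t) ⟩
  β (+ 2 * (t + 1ℤ))                   ≡⟨ shifted′ ⟩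
  β (+ 2 * (t + 1ℤ) + 1ℤ)              ≡⟨ β-pairs (t + 1ℤ) ⟩
  not (β (+ 2 * (t + 1ℤ)))             ≡⟨ cong (not ∘ β) (sym (arith t)) ⟩
  not (β (+ 2 * t + 1ℤ + + 1))         ∎)
  where
  open ≡-Reasoning
  arith : ∀ t → + 2 * t + 1ℤ + + 1 ≡ + 2 * (t + 1ℤ)
  arith = solve-∀
  arith′ : ∀ t → + 2 * t + 1ℤ + + 1 + + 1 ≡ + 2 * (t + 1ℤ) + 1ℤ
  arith′ = solve-∀
  shifted′ : β (+ 2 * (t + 1ℤ)) ≡ β (+ 2 * (t + 1ℤ) + 1ℤ)
  shifted′ = trans (cong β (sym (arith t))) (trans shifted (cong β (arith′ t)))

descend-2-long : ∀ q₀ M → 3 ≤ℕ M → Square W (+ 4 * q₀ + + 2) (4 *ℕ M) → Square W (q₀ + 1ℤ) M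
descend-2-long q₀ M 3≤M sq = square (halfParity-shift (Q 0) M (cong proj₁ (blocks 0 (ℕ.<-≤-trans (s≤s (s≤s z≤n)) 3≤M)))
                                       (cong proj₁ (subst (λ z → W z ≡ W (z + + M)) (next q₀) (blocks 1 3≤M))))
  where
  open Descent q₀ d2 M sq
  Q : ℕ → ℤ
  Q j = q₀ + 1ℤ + + j
  blocks : ∀ j → suc j <ℕ M → W (Q j) ≡ W (Q j + + M)
  blocks j sj<M = W-shift (Q j)
    (β-shift₀ j 2 (Q j) (ℕ.<⇒≤ sj<M) 2<4 (position-carry q₀ (+ j) (+ 2) (+ 2)))
    (letter-shift (suc j) 0 (Q j) d2 sj<M 0<4 (position-next q₀ (+ j) (+ 2) (+ 0)))
  next : ∀ q → q + 1ℤ + + 1 ≡ q + 1ℤ + + 0 + 1ℤ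
  next = solve-∀
  square : (∃ λ M′ → M ≡ 4 *ℕ M′) → Square W (q₀ + 1ℤ) M
  square (M′ , M≡4M′) j j<M = cong₂ _,_
    (sym (trans (cong (λ z → halfParity (Q j + z)) (trans (cong +_ M≡4M′) (ℤ.pos-* 4 M′))) (halfParity-+4M M′ (Q j))))
    (β-shift₀ j 2 (Q j) j<M 2<4 (position-carry q₀ (+ j) (+ 2) (+ 2)))

-- Starting at 4q₀ + 2 the last block lacks its letter at 4Q + 2, so halfParity
-- on the shifted copy is only known through its period: M must again be a
-- multiple of 4, which fails for M = 1, 2.
descend-2 : ∀ q₀ M → 1 ≤ℕ M → Square W (+ 4 * q₀ + + 2) (4 *ℕ M) → ∃ λ q → Square W q M
descend-2 q₀ 1 _ sq = ⊥-elim (short-square-impossible a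
  (trans (sym (β-digit a d2)) (trans (letter-shift 0 0 (q₀ + + 0) d2 (s≤s z≤n) 0<4 (position q₀ (+ 0) (+ 2) (+ 0))) (β-digit (a + + 1) d2)))
  (subst (λ b → β b ≡ β (b + + 1)) (arith q₀)
    (β-shift₀ 0 2 (q₀ + 1ℤ + + 0) (s≤s z≤n) 2<4 (position-carry q₀ (+ 0) (+ 2) (+ 2)))))
  where
  open Descent q₀ d2 1 sq
  a = q₀ + + 0
  arith : ∀ q → q + 1ℤ + + 0 ≡ q + + 0 + + 1
  arith = solve-∀
descend-2 q₀ 2 _ sq = ⊥-elim (W-+2 (q₀ + 1ℤ + + 0) (W-shift (q₀ + 1ℤ + + 0)
  (β-shift₀ 0 2 (q₀ + 1ℤ + + 0) (s≤s z≤n) 2<4 (position-carry q₀ (+ 0) (+ 2) (+ 2)))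
  (letter-shift 1 0 (q₀ + 1ℤ + + 0) d2 (s≤s (s≤s z≤n)) 0<4 (position-next q₀ (+ 0) (+ 2) (+ 0)))))
  where open Descent q₀ d2 2 sq
descend-2 q₀ M@(suc (suc (suc _))) _ sq = q₀ + 1ℤ , descend-2-long q₀ M (s≤s (s≤s (s≤s z≤n))) sq

W-square-descends : ∀ q₀ r₀ M → 1 ≤ℕ M → Square W (+ 4 * q₀ + + value r₀) (4 *ℕ M) → ∃ λ q → Square W q M
W-square-descends q₀ d0 M _ sq = q₀ , descend-0 q₀ M sq
W-square-descends q₀ d1 M _ sq = q₀ , descend-1 q₀ M sq
W-square-descends q₀ d2 M 1≤M sq = descend-2 q₀ M 1≤M sq
W-square-descends q₀ d3 M _ sq = q₀ + 1ℤ , descend-3 q₀ M sq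

W-square-length : ∀ p L → 1 ≤ℕ L → Square W p L → ∃ λ M → 1 ≤ℕ M × L ≡ 4 *ℕ M
W-square-length p 1 _ sq = ⊥-elim (W-+1 p (square-start W p sq (s≤s z≤n)))
W-square-length p L@(suc (suc _)) _ sq
  with halfParity-shift p L (cong proj₁ (square-start W p sq (s≤s z≤n))) (cong proj₁ (sq 1 (s≤s (s≤s z≤n))))
... | suc M , L≡4M = suc M , s≤s z≤n , L≡4M

W-squareFree : SquareFree W
W-squareFree p L = <-rec (λ L → ∀ p → 1 ≤ℕ L → ¬ Square W p L) descend L p
  where
  descend : ∀ L → (∀ {L′} → L′ <ℕ L → ∀ p → 1 ≤ℕ L′ → ¬ Square W p L′) → ∀ p → 1 ≤ℕ L → ¬ Square W p L
  descend L ih p 1≤L sq with W-square-length p L 1≤L sq | quotient-digit p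
  ... | M@(suc _) , 1≤M , refl | q₀ , r₀ , refl with W-square-descends q₀ r₀ M 1≤M sq
  ... | q , sq′ = ih (ℕ.m<m+n M (s≤s z≤n)) q 1≤M sq′

-- Twelve colours

bit : Bool → Fin 2
bit false = 0F
bit true = sucF 0F

bit-injective : Injective _≡_ _≡_ bit
bit-injective {false} {false} _ = refl
bit-injective {true} {true} _ = refl

encode : (Bool × Bool) × Fin 3 → Fin 12
encode ((a , b) , t) = combine (combine (bit a) (bit b)) t

encode-injective : Injective _≡_ _≡_ encode
encode-injective {(a , b) , t} {(a′ , b′) , t′} eq with combine-injective (combine (bit a) (bit b)) t (combine (bit a′) (bit b′)) t′ eq
... | eq₁ , refl with combine-injective (bit a) (bit b) (bit a′) (bit b′) eq₁
... | eqa , eqb = cong (_, t) (cong₂ _,_ (bit-injective eqa) (bit-injective eqb))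

theorem2 : π≤ (P □ P) 12
theorem2 = encode ∘ colour , nonRepetitive-∘ encode-injective colour-nonRepetitive
  where open DiagonalColouring {f = W} {g = ternaryThueMorse} W-squareFree W-+2 ternaryThueMorse-squareFree
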